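{- The poset $C(m,n)\sqcup\{ -1\}$, obtained from $C(m,n)$ by adjoining a formal minimum element $-1$, is a lattice.
   Context: Fix positive integers $m,n$. $\mathsf{Coll}(m,n)$ is the finite set of formal symbols $m_1,\dots,m_{m-1}$ and $l_i$, $1\le i\le n-1$. A preorder is a reflexive transitive relation $\le$; write $x\equiv y$ if $x\le y$ and $y\le x$, $x<y$ if $x\le y$ but not $y\le x$, and call $x,y$ comparable if $x\le y$ or $y\le x$. Pairs $\{m_j,l_i\}$ are orthogonal; pairs $\{m_j,m_{j'}\}$ or $\{l_i,l_{i'}\}$ are parallel. Given a preorder, an orthogonal link between parallel $m_i,m_j$ is an $l_s$ with $m_i\le l_s\le m_j$ or $m_j\le l_s\le m_i$; a gap between $m_i,m_j$ is an $m_s$ with $s$ between $i$ and $j$ inclusive and $m_i<m_s$, $m_j<m_s$; links and gaps between $l_i,l_j$ are defined symmetrically (roles of $m$ and $l$ swapped). The preorder is a good rectangular preorder if (1) any two orthogonal collisions are comparable, and (2) two parallel collisions are comparable iff there is an orthogonal link between them or there is no gap between them. $C(m,n)$ is the set of good rectangular preorders on $\mathsf{Coll}(m,n)$ partially ordered by refinement: $P\le Q$ iff $x\le_P y$ implies $x\le_Q y$ (i.e. $P\subseteq Q$ as subsets of $\mathsf{Coll}(m,n)^2$). -}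

module Defs where

open import Data.Nat using (ℕ; _∸_)
open import Data.Fin using (Fin)
open import Data.Fin.Base using () renaming (_≤_ to _≤ᶠ_)
open import Data.Bool using (Bool; true; false)
open import Data.Sum using (_⊎_; inj₁; inj₂)
open import Data.Product using (Σ; _×_; ∃; _,_; proj₁)
open import Data.Maybe using (Maybe; just; nothing)
open import Data.Empty using (⊥)
open import Data.Unit using (⊤)
open import Relation.Nullary using (¬_)
open import Relation.Binary.PropositionalEquality using (_≡_)
open import Function.Bundles using (_⇔_)

-- Coll(m,n): m_1..m_{m-1} are inj₁ (j : Fin (m ∸ 1)) (m_{j+1}),
--            l_1..l_{n-1} are inj₂ (i : Fin (n ∸ 1)) (l_{i+1}).
Coll : ℕ → ℕ → Set
Coll m n = Fin (m ∸ 1) ⊎ Fin (n ∸ 1)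

BRel : ℕ → ℕ → Set
BRel m n = Coll m n → Coll m n → Bool

module _ {m n : ℕ} (R : BRel m n) where

  _≼_ : Coll m n → Coll m n → Set
  x ≼ y = R x y ≡ true

  _≺_ : Coll m n → Coll m n → Set
  x ≺ y = (x ≼ y) × ¬ (y ≼ x)

  Comparable : Coll m n → Coll m n → Set
  Comparable x y = (x ≼ y) ⊎ (y ≼ x)

  IsPreorder : Set
  IsPreorder = (∀ x → x ≼ x) × (∀ x y z → x ≼ y → y ≼ z → x ≼ z)

  Between : ∀ {k} → Fin k → Fin k → Fin k → Set
  Between i s j = ((i ≤ᶠ s) × (s ≤ᶠ j)) ⊎ ((j ≤ᶠ s) × (s ≤ᶠ i))

  -- condition (2) for a parallel family p (indexed by Fin a) with
  -- orthogonal family q (indexed by Fin b)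
  module _ {a b : ℕ} (p : Fin a → Coll m n) (q : Fin b → Coll m n) where

    Link : Fin a → Fin a → Set
    Link i j = ∃ λ (s : Fin b) →
      ((p i ≼ q s) × (q s ≼ p j)) ⊎ ((p j ≼ q s) × (q s ≼ p i))

    Gap : Fin a → Fin a → Set
    Gap i j = ∃ λ (s : Fin a) → Between i s j × (p i ≺ p s) × (p j ≺ p s)

    ParallelCond : Set
    ParallelCond = ∀ i j → Comparable (p i) (p j) ⇔ (Link i j ⊎ ¬ Gap i j)

  IsGoodRectangular : Set
  IsGoodRectangular =
      IsPreorder
    × (∀ (j : Fin (m ∸ 1)) (i : Fin (n ∸ 1)) → Comparable (inj₁ j) (inj₂ i))
    × ParallelCond inj₁ inj₂
    × ParallelCond inj₂ inj₁

C : ℕ → ℕ → Set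
C m n = Σ (BRel m n) (IsGoodRectangular {m} {n})

_⊑_ : ∀ {m n} → C m n → C m n → Set
_⊑_ {m} {n} (P , _) (Q , _) = ∀ (x y : Coll m n) → P x y ≡ true → Q x y ≡ true

-- C(m,n) ⊔ {-1}: nothing is the adjoined minimum -1
C⊥ : ℕ → ℕ → Set
C⊥ m n = Maybe (C m n)

_⊑⊥_ : ∀ {m n} → C⊥ m n → C⊥ m n → Set
nothing ⊑⊥ _ = ⊤
just P ⊑⊥ nothing = ⊥
_⊑⊥_ {m} {n} (just P) (just Q) = _⊑_ {m} {n} P Q

Ord⊥ : (m n : ℕ) → C⊥ m n → C⊥ m n → Set
Ord⊥ m n = _⊑⊥_ {m} {n}

-- The join of P and Q is the preorder generated by P ∪ Q, and their meet is the
-- preorder generated by the union of all good preorders below both (or -1 when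
-- there is none). Both are good because the preorder T generated by a union U
-- of good preorders, at least one of them, is good. Orthogonal comparability is
-- inherited from any member of U. Call parallel collisions i ≤ j linked or
-- dominated if some orthogonal link joins them or every collision between them
-- lies below j. In a good preorder every i ≤ j is linked or dominated (else a
-- gap appears), and the property survives composition, so it holds along T; a
-- dominated pair has no gap, which gives one half of condition (2). For the
-- other half, a gap of a member of U between T-incomparable collisions is also
-- a gap of T. As Coll(m,n) is finite, intersections and unions over all
-- relations are computed by exhaustive search.

{-# OPTIONS --safe #-}
module Submission where

open import Defs
open import Data.Nat using (ℕ; _≤_; zero; suc)
open import Data.Product using (Σ; _×_; _,_; proj₁; proj₂; ∃)
open import Algebra.Core using (Op₂)
open import Relation.Binary.Lattice.Definitions using (Supremum; Infimum)

open import Data.Bool using (Bool; true; false; _∨_)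
open import Data.Bool.Properties using (_≟_; ∨-zeroʳ)
open import Data.Empty using (⊥-elim)
open import Data.Fin using (Fin; zero; suc)
open import Data.Fin.Base using () renaming (_≤_ to _≤ᶠ_)
import Data.Fin.Properties as Fin
open import Data.Maybe using (nothing; just)
open import Data.Sum using (_⊎_; inj₁; inj₂; [_,_]′; map₂) renaming (map to map-⊎)
open import Data.Unit using (⊤; tt)
open import Data.Vec.Functional using (_∷_; tail)
open import Function.Base using (id)
open import Function.Bundles using (_⇔_; mk⇔; Equivalence)
open import Relation.Nullary using (¬_; Dec; yes; no; does; ¬?; _×-dec_; _⊎-dec_; _→-dec_)
open import Relation.Nullary.Decidable using (dec-true; map′)
open import Relation.Binary.PropositionalEquality using (_≡_; refl; sym; trans; subst)

does⇒ : {A : Set} (a? : Dec A) → does a? ≡ true → A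
does⇒ (yes a) _ = a
does⇒ (no _) ()

_⇔-dec_ : {A B : Set} → Dec A → Dec B → Dec (A ⇔ B)
a? ⇔-dec b? = map′ (λ (f , g) → mk⇔ f g) (λ e → Equivalence.to e , Equivalence.from e)
                   ((a? →-dec b?) ×-dec (b? →-dec a?))

Pointwise : {A X : Set} → (X → X → Set) → (A → X) → (A → X) → Set
Pointwise _≈_ f g = ∀ a → f a ≈ g a

-- Without function extensionality a search through a function space can only
-- rebuild its witness up to pointwise equality, hence the invariance hypothesis.
Searchable : (X : Set) → (X → X → Set) → Set₁
Searchable X _≈_ = (P : X → Set) → (∀ {x y} → x ≈ y → P x → P y) →
                   (∀ x → Dec (P x)) → Dec (∃ P)

searchable-Bool : Searchable Bool _≡_
searchable-Bool P _ P? with P? true | P? false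
... | yes t | _     = yes (true , t)
... | no _  | yes f = yes (false , f)
... | no ¬t | no ¬f = no λ { (true , t) → ¬t t ; (false , f) → ¬f f }

module _ {X : Set} {_≈_ : X → X → Set} (≈-refl : ∀ {x} → x ≈ x) where

  searchable-Fin→ : Searchable X _≈_ → ∀ k → Searchable (Fin k → X) (Pointwise _≈_)
  searchable-Fin→ _ zero P resp P? =
    map′ (λ p → _ , p) (λ (f , p) → resp {f} (λ ()) p) (P? (λ ()))
  searchable-Fin→ search (suc k) P resp P? =
    map′ (λ (x , f , p) → x ∷ f , p)
         (λ (f , p) → f zero , tail f , resp (λ { zero → ≈-refl ; (suc _) → ≈-refl }) p)
         (search (λ x → ∃ λ f → P (x ∷ f))
                 (λ x≈y (f , p) → f , resp (λ { zero → x≈y ; (suc _) → ≈-refl }) p)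
                 (λ x → searchable-Fin→ search k (λ f → P (x ∷ f))
                          (λ f≈g → resp (λ { zero → ≈-refl ; (suc i) → f≈g i }))
                          (λ f → P? (x ∷ f))))

  searchable-⊎→ : {A B : Set} →
                  Searchable (A → X) (Pointwise _≈_) → Searchable (B → X) (Pointwise _≈_) →
                  Searchable (A ⊎ B → X) (Pointwise _≈_)
  searchable-⊎→ searchA searchB P resp P? =
    map′ (λ (f , g , p) → [ f , g ]′ , p)
         (λ (h , p) → (λ a → h (inj₁ a)) , (λ b → h (inj₂ b)) ,
                      resp (λ { (inj₁ _) → ≈-refl ; (inj₂ _) → ≈-refl }) p)
         (searchA (λ f → ∃ λ g → P [ f , g ]′)
                  (λ f≈f′ (g , p) → g , resp (λ { (inj₁ a) → f≈f′ a ; (inj₂ _) → ≈-refl }) p)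
                  (λ f → searchB (λ g → P [ f , g ]′)
                           (λ g≈g′ → resp (λ { (inj₁ _) → ≈-refl ; (inj₂ b) → g≈g′ b }))
                           (λ g → P? [ f , g ]′)))

_∈[_,_] : ∀ {k} → Fin k → Fin k → Fin k → Set
s ∈[ i , j ] = ((i ≤ᶠ s) × (s ≤ᶠ j)) ⊎ ((j ≤ᶠ s) × (s ≤ᶠ i))

module _ {k : ℕ} where

  _∈[_,_]? : (s i j : Fin k) → Dec (s ∈[ i , j ])
  s ∈[ i , j ]? = ((i Fin.≤? s) ×-dec (s Fin.≤? j)) ⊎-dec ((j Fin.≤? s) ×-dec (s Fin.≤? i))

  ∈[i,i]⇒≡ : ∀ {s i : Fin k} → s ∈[ i , i ] → s ≡ i
  ∈[i,i]⇒≡ (inj₁ (i≤s , s≤i)) = Fin.≤-antisym s≤i i≤s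
  ∈[i,i]⇒≡ (inj₂ (i≤s , s≤i)) = Fin.≤-antisym s≤i i≤s

  ∈[]-sym : ∀ {s i j : Fin k} → s ∈[ i , j ] → s ∈[ j , i ]
  ∈[]-sym (inj₁ x) = inj₂ x
  ∈[]-sym (inj₂ x) = inj₁ x

  ∈[]-split : ∀ {s i l : Fin k} → s ∈[ i , l ] → ∀ j → s ∈[ i , j ] ⊎ s ∈[ j , l ]
  ∈[]-split {s} (inj₁ (i≤s , s≤l)) j with Fin.≤-total j s
  ... | inj₁ j≤s = inj₂ (inj₁ (j≤s , s≤l))
  ... | inj₂ s≤j = inj₁ (inj₁ (i≤s , s≤j))
  ∈[]-split {s} (inj₂ (l≤s , s≤i)) j with Fin.≤-total j s
  ... | inj₁ j≤s = inj₁ (inj₂ (j≤s , s≤i))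
  ... | inj₂ s≤j = inj₂ (inj₂ (l≤s , s≤j))

  ∈[]-narrow : ∀ {s u i j : Fin k} → s ∈[ i , j ] → u ∈[ s , j ] → u ∈[ i , j ]
  ∈[]-narrow (inj₁ (i≤s , s≤j)) (inj₁ (s≤u , u≤j)) = inj₁ (Fin.≤-trans i≤s s≤u , u≤j)
  ∈[]-narrow (inj₁ (i≤s , s≤j)) (inj₂ (j≤u , u≤s)) =
    inj₁ (Fin.≤-trans i≤s (Fin.≤-trans s≤j j≤u) , Fin.≤-trans u≤s s≤j)
  ∈[]-narrow (inj₂ (j≤s , s≤i)) (inj₁ (s≤u , u≤j)) =
    inj₂ (Fin.≤-trans j≤s s≤u , Fin.≤-trans u≤j (Fin.≤-trans j≤s s≤i))
  ∈[]-narrow (inj₂ (j≤s , s≤i)) (inj₂ (j≤u , u≤s)) = inj₂ (j≤u , Fin.≤-trans u≤s s≤i)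

-- The predicates of Defs take m and n implicitly, and these cannot be inferred
-- from a relation, whose type only mentions m ∸ 1 and n ∸ 1: hence the {m} {n}.
module _ {m n : ℕ} where

  infix 4 _⊆_ _≐_
  infixr 6 _∪_

  _⊆_ : BRel m n → BRel m n → Set
  R ⊆ S = ∀ x y → R x y ≡ true → S x y ≡ true

  _≐_ : BRel m n → BRel m n → Set
  R ≐ S = ∀ x y → R x y ≡ S x y

  ⊆-trans : ∀ {R S V : BRel m n} → R ⊆ S → S ⊆ V → R ⊆ V
  ⊆-trans R⊆S S⊆V x y Rxy = S⊆V x y (R⊆S x y Rxy)

  ≐-sym : ∀ {R S : BRel m n} → R ≐ S → S ≐ R
  ≐-sym R≐S x y = sym (R≐S x y)

  ≐⇒⊆ : ∀ {R S : BRel m n} → R ≐ S → R ⊆ S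
  ≐⇒⊆ R≐S x y = trans (sym (R≐S x y))

  searchable-BRel : Searchable (BRel m n) _≐_
  searchable-BRel = searchable-⊎→ {_≈_ = Pointwise _≡_} (λ _ → refl)
                      (searchable-Fin→ (λ _ → refl) searchable-row _)
                      (searchable-Fin→ (λ _ → refl) searchable-row _)
    where
    searchable-row : Searchable (Coll m n → Bool) (Pointwise _≡_)
    searchable-row = searchable-⊎→ {_≈_ = _≡_} refl (searchable-Fin→ refl searchable-Bool _)
                                                   (searchable-Fin→ refl searchable-Bool _)

  ≼? : (R : BRel m n) → ∀ x y → Dec (R x y ≡ true)
  ≼? R x y = R x y ≟ true

  ≺? : (R : BRel m n) → ∀ x y → Dec (_≺_ {m} {n} R x y)
  ≺? R x y = ≼? R x y ×-dec ¬? (≼? R y x)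

  comparable? : (R : BRel m n) → ∀ x y → Dec (Comparable {m} {n} R x y)
  comparable? R x y = ≼? R x y ⊎-dec ≼? R y x

  all-Coll? : {P : Coll m n → Set} → (∀ x → Dec (P x)) → Dec (∀ x → P x)
  all-Coll? P? = map′ (λ (f , g) → λ { (inj₁ i) → f i ; (inj₂ i) → g i })
                      (λ h → (λ i → h (inj₁ i)) , (λ i → h (inj₂ i)))
                      (Fin.all? (λ i → P? (inj₁ i)) ×-dec Fin.all? (λ i → P? (inj₂ i)))

  ⊆? : (R S : BRel m n) → Dec (R ⊆ S)
  ⊆? R S = all-Coll? λ x → all-Coll? λ y → ≼? R x y →-dec ≼? S x y

  isPreorder? : (R : BRel m n) → Dec (IsPreorder {m} {n} R)
  isPreorder? R = all-Coll? (λ x → ≼? R x x) ×-dec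
                  all-Coll? (λ x → all-Coll? λ y → all-Coll? λ z →
                    ≼? R x y →-dec (≼? R y z →-dec ≼? R x z))

  isPreorder-resp : ∀ {R S : BRel m n} → R ≐ S → IsPreorder {m} {n} R → IsPreorder {m} {n} S
  isPreorder-resp R≐S (reflexive , transitive) =
    (λ x → ≐⇒⊆ R≐S x x (reflexive x)) ,
    λ x y z Sxy Syz → ≐⇒⊆ R≐S x z (transitive x y z (≐⇒⊆ (≐-sym R≐S) x y Sxy)
                                                (≐⇒⊆ (≐-sym R≐S) y z Syz))

  ≼-trans : ∀ {R : BRel m n} → IsPreorder {m} {n} R →
            ∀ {x y z} → R x y ≡ true → R y z ≡ true → R x z ≡ true
  ≼-trans (_ , transitive) {x} {y} {z} = transitive x y z

  ≺-resp : ∀ {R S : BRel m n} → R ≐ S → ∀ {x y} → _≺_ {m} {n} R x y → _≺_ {m} {n} S x y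
  ≺-resp R≐S {x} {y} (Rxy , Ryx⇏) = ≐⇒⊆ R≐S x y Rxy , λ Syx → Ryx⇏ (≐⇒⊆ (≐-sym R≐S) y x Syx)

  comparable-mono : ∀ {R S : BRel m n} → R ⊆ S →
                    ∀ {x y} → Comparable {m} {n} R x y → Comparable {m} {n} S x y
  comparable-mono R⊆S {x} {y} (inj₁ Rxy) = inj₁ (R⊆S x y Rxy)
  comparable-mono R⊆S {x} {y} (inj₂ Ryx) = inj₂ (R⊆S y x Ryx)

  module Parallel {a b : ℕ} (p : Fin a → Coll m n) (q : Fin b → Coll m n) where

    link? : (R : BRel m n) → ∀ i j → Dec (Link {m} {n} R p q i j)
    link? R i j = Fin.any? λ s → (≼? R (p i) (q s) ×-dec ≼? R (q s) (p j)) ⊎-dec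
                                 (≼? R (p j) (q s) ×-dec ≼? R (q s) (p i))

    gap? : (R : BRel m n) → ∀ i j → Dec (Gap {m} {n} R p q i j)
    gap? R i j = Fin.any? λ s → s ∈[ i , j ]? ×-dec (≺? R (p i) (p s) ×-dec ≺? R (p j) (p s))

    parallelCond? : (R : BRel m n) → Dec (ParallelCond {m} {n} R p q)
    parallelCond? R = Fin.all? λ i → Fin.all? λ j →
      comparable? R (p i) (p j) ⇔-dec (link? R i j ⊎-dec ¬? (gap? R i j))

    link-sym : ∀ {R : BRel m n} {i j} → Link {m} {n} R p q i j → Link {m} {n} R p q j i
    link-sym (s , inj₁ x) = s , inj₂ x
    link-sym (s , inj₂ x) = s , inj₁ x

    link-mono : ∀ {R S : BRel m n} → R ⊆ S →
                ∀ {i j} → Link {m} {n} R p q i j → Link {m} {n} S p q i j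
    link-mono R⊆S {i} {j} (s , inj₁ (i≤s , s≤j)) =
      s , inj₁ (R⊆S (p i) (q s) i≤s , R⊆S (q s) (p j) s≤j)
    link-mono R⊆S {i} {j} (s , inj₂ (j≤s , s≤i)) =
      s , inj₂ (R⊆S (p j) (q s) j≤s , R⊆S (q s) (p i) s≤i)

    gap-sym : ∀ {R : BRel m n} {i j} → Gap {m} {n} R p q i j → Gap {m} {n} R p q j i
    gap-sym (s , s∈ , i<s , j<s) = s , ∈[]-sym s∈ , j<s , i<s

    gap-resp : ∀ {R S : BRel m n} → R ≐ S →
               ∀ {i j} → Gap {m} {n} R p q i j → Gap {m} {n} S p q i j
    gap-resp R≐S (s , s∈ , i<s , j<s) = s , s∈ , ≺-resp R≐S i<s , ≺-resp R≐S j<s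

    parallelCond-resp : ∀ {R S : BRel m n} → R ≐ S →
                        ParallelCond {m} {n} R p q → ParallelCond {m} {n} S p q
    parallelCond-resp R≐S pc i j = mk⇔
      (λ c → transfer R≐S (Equivalence.to (pc i j) (comparable-mono (≐⇒⊆ (≐-sym R≐S)) c)))
      (λ lg → comparable-mono (≐⇒⊆ R≐S) (Equivalence.from (pc i j) (transfer (≐-sym R≐S) lg)))
      where
      transfer : ∀ {R S : BRel m n} → R ≐ S →
                 Link {m} {n} R p q i j ⊎ ¬ Gap {m} {n} R p q i j →
                 Link {m} {n} S p q i j ⊎ ¬ Gap {m} {n} S p q i j
      transfer R≐S = map-⊎ (link-mono (≐⇒⊆ R≐S)) (λ ¬gap gap → ¬gap (gap-resp (≐-sym R≐S) gap))

    Dominated : BRel m n → Fin a → Fin a → Set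
    Dominated R i j = ∀ s → s ∈[ i , j ] → R (p s) (p j) ≡ true

    LinkedOrDominated : BRel m n → Fin a → Fin a → Set
    LinkedOrDominated R i j = Link {m} {n} R p q i j ⊎ Dominated R i j

    linkedOrDominated? : (R : BRel m n) → ∀ i j → Dec (LinkedOrDominated R i j)
    linkedOrDominated? R i j =
      link? R i j ⊎-dec Fin.all? (λ s → s ∈[ i , j ]? →-dec ≼? R (p s) (p j))

    linkedOrDominated-mono : ∀ {R S : BRel m n} → R ⊆ S → ∀ {i j} →
                             LinkedOrDominated R i j → LinkedOrDominated S i j
    linkedOrDominated-mono R⊆S {j = j} =
      map-⊎ (link-mono R⊆S) (λ dominated s s∈ → R⊆S (p s) (p j) (dominated s s∈))

    dominated⇒¬gap : ∀ {R : BRel m n} {i j} → Dominated R i j → ¬ Gap {m} {n} R p q i j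
    dominated⇒¬gap dominated (s , s∈ , _ , (_ , s≰j)) = s≰j (dominated s s∈)

    module _ {R : BRel m n} (pre : IsPreorder {m} {n} R) where

      link-oriented : ∀ {i j} → R (p i) (p j) ≡ true → Link {m} {n} R p q i j →
                      ∃ λ s → R (p i) (q s) ≡ true × R (q s) (p j) ≡ true
      link-oriented _   (s , inj₁ (i≤s , s≤j)) = s , i≤s , s≤j
      link-oriented i≤j (s , inj₂ (j≤s , s≤i)) = s , ≼-trans pre i≤j j≤s , ≼-trans pre s≤i i≤j

      linkedOrDominated-refl : ∀ i → LinkedOrDominated R i i
      linkedOrDominated-refl i = inj₂ λ s s∈ →
        subst (λ s → R (p s) (p i) ≡ true) (sym (∈[i,i]⇒≡ s∈)) (proj₁ pre (p i))

      linkedOrDominated-trans : ∀ {i j k} → R (p i) (p j) ≡ true → R (p j) (p k) ≡ true →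
                                LinkedOrDominated R i j → LinkedOrDominated R j k →
                                LinkedOrDominated R i k
      linkedOrDominated-trans i≤j j≤k (inj₁ link) _ =
        let (s , i≤s , s≤j) = link-oriented i≤j link in inj₁ (s , inj₁ (i≤s , ≼-trans pre s≤j j≤k))
      linkedOrDominated-trans i≤j j≤k (inj₂ _) (inj₁ link) =
        let (s , j≤s , s≤k) = link-oriented j≤k link in inj₁ (s , inj₁ (≼-trans pre i≤j j≤s , s≤k))
      linkedOrDominated-trans {j = j} i≤j j≤k (inj₂ dom-ij) (inj₂ dom-jk) = inj₂ λ s s∈ →
        [ (λ s∈ij → ≼-trans pre (dom-ij s s∈ij) j≤k) , dom-jk s ]′ (∈[]-split s∈ j)

      ≼⇒linkedOrDominated : ParallelCond {m} {n} R p q → ∀ {i j} →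
                            R (p i) (p j) ≡ true → LinkedOrDominated R i j
      ≼⇒linkedOrDominated pc {i} {j} i≤j with link? R i j
      ... | yes link = inj₁ link
      ... | no ¬link = inj₂ dominated
        where
        ¬gap : ¬ Gap {m} {n} R p q i j
        ¬gap = [ (λ link _ → ¬link link) , id ]′ (Equivalence.to (pc i j) (inj₁ i≤j))

        above⇒gap : ∀ {u} → u ∈[ i , j ] → _≺_ {m} {n} R (p j) (p u) → Gap {m} {n} R p q i j
        above⇒gap {u} u∈ (j≤u , u≰j) =
          u , u∈ , (≼-trans pre i≤j j≤u , λ u≤i → u≰j (≼-trans pre u≤i i≤j)) , (j≤u , u≰j)

        -- If s and j are incomparable, the condition for the pair (s , j) yields
        -- a gap between them, which is also a gap between i and j.
        dominated : Dominated R i j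
        dominated s s∈ with ≼? R (p s) (p j) | ≼? R (p j) (p s) | gap? R s j
        ... | yes s≤j | _        | _ = s≤j
        ... | no s≰j  | yes j≤s  | _ = ⊥-elim (¬gap (above⇒gap s∈ (j≤s , s≰j)))
        ... | no _    | no _     | yes (u , u∈ , _ , j<u) =
          ⊥-elim (¬gap (above⇒gap (∈[]-narrow s∈ u∈) j<u))
        ... | no s≰j  | no j≰s   | no ¬gap-sj =
          ⊥-elim ([ s≰j , j≰s ]′ (Equivalence.from (pc s j) (inj₂ ¬gap-sj)))

      parallelCond-from-linkedOrDominated :
        ∀ {G : BRel m n} → G ⊆ R → ParallelCond {m} {n} G p q →
        (∀ i j → R (p i) (p j) ≡ true → LinkedOrDominated R i j) → ParallelCond {m} {n} R p q
      parallelCond-from-linkedOrDominated {G} G⊆R pcG lod i j = mk⇔ to from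
        where
        to : Comparable {m} {n} R (p i) (p j) → Link {m} {n} R p q i j ⊎ ¬ Gap {m} {n} R p q i j
        to (inj₁ i≤j) = map₂ (dominated⇒¬gap {R}) (lod i j i≤j)
        to (inj₂ j≤i) = map-⊎ (link-sym {R} {j} {i})
                              (λ dom gap → dominated⇒¬gap {R} dom (gap-sym {R} {i} {j} gap))
                              (lod j i j≤i)

        from : Link {m} {n} R p q i j ⊎ ¬ Gap {m} {n} R p q i j → Comparable {m} {n} R (p i) (p j)
        from (inj₁ (s , inj₁ (i≤s , s≤j))) = inj₁ (≼-trans pre i≤s s≤j)
        from (inj₁ (s , inj₂ (j≤s , s≤i))) = inj₂ (≼-trans pre j≤s s≤i)
        from (inj₂ ¬gap) with comparable? R (p i) (p j)
        ... | yes comparable = comparable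
        ... | no incomparable =
          ⊥-elim (incomparable (comparable-mono G⊆R (Equivalence.from (pcG i j) (inj₂ ¬gapG))))
          where
          -- While i and j are R-incomparable, every G-gap is an R-gap.
          ¬gapG : ¬ Gap {m} {n} G p q i j
          ¬gapG (s , s∈ , (i≤s , _) , (j≤s , _)) = ¬gap
            (s , s∈ , (G⊆R _ _ i≤s , λ s≤i → incomparable (inj₂ (≼-trans pre (G⊆R _ _ j≤s) s≤i)))
                    , (G⊆R _ _ j≤s , λ s≤j → incomparable (inj₁ (≼-trans pre (G⊆R _ _ i≤s) s≤j))))

  module M = Parallel inj₁ inj₂
  module L = Parallel inj₂ inj₁

  isGoodRectangular? : (R : BRel m n) → Dec (IsGoodRectangular {m} {n} R)
  isGoodRectangular? R =
    isPreorder? R ×-dec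
    (Fin.all? (λ j → Fin.all? λ i → comparable? R (inj₁ j) (inj₂ i)) ×-dec
     (M.parallelCond? R ×-dec L.parallelCond? R))

  isGoodRectangular-resp : ∀ {R S : BRel m n} → R ≐ S →
                           IsGoodRectangular {m} {n} R → IsGoodRectangular {m} {n} S
  isGoodRectangular-resp R≐S (pre , orth , pcM , pcL) =
    isPreorder-resp R≐S pre , (λ j i → comparable-mono (≐⇒⊆ R≐S) (orth j i)) ,
    M.parallelCond-resp R≐S pcM , L.parallelCond-resp R≐S pcL

  Separates : BRel m n → Coll m n → Coll m n → BRel m n → Set
  Separates U x y R = IsPreorder {m} {n} R × U ⊆ R × ¬ (R x y ≡ true)

  separated? : ∀ U x y → Dec (∃ (Separates U x y))
  separated? U x y = searchable-BRel (Separates U x y) resp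
    (λ R → isPreorder? R ×-dec (⊆? U R ×-dec ¬? (≼? R x y)))
    where
    resp : ∀ {R S} → R ≐ S → Separates U x y R → Separates U x y S
    resp R≐S (pre , U⊆R , Rxy⇏) =
      isPreorder-resp R≐S pre , ⊆-trans U⊆R (≐⇒⊆ R≐S) ,
      λ Sxy → Rxy⇏ (≐⇒⊆ (≐-sym R≐S) x y Sxy)

  -- The intersection of all preorders containing U, kept opaque so that type
  -- checking never unfolds the exhaustive search.
  opaque
    closure : BRel m n → BRel m n
    closure U x y = does (¬? (separated? U x y))

    closure-least : ∀ {U R : BRel m n} → IsPreorder {m} {n} R → U ⊆ R → closure U ⊆ R
    closure-least {U} {R} pre U⊆R x y Uxy with ≼? R x y
    ... | yes Rxy = Rxy
    ... | no Rxy⇏ = ⊥-elim (does⇒ (¬? (separated? U x y)) Uxy (R , pre , U⊆R , Rxy⇏))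

    ⊆-closure : ∀ U → U ⊆ closure U
    ⊆-closure U x y Uxy =
      dec-true (¬? (separated? U x y)) λ (_ , _ , U⊆R , Rxy⇏) → Rxy⇏ (U⊆R x y Uxy)

    closure-isPreorder : ∀ U → IsPreorder {m} {n} (closure U)
    closure-isPreorder U =
      (λ x → dec-true (¬? (separated? U x x)) λ (_ , pre , _ , Rxx⇏) → Rxx⇏ (proj₁ pre x)) ,
      λ x y z xy yz → dec-true (¬? (separated? U x z)) λ (_ , pre , U⊆R , Rxz⇏) →
        Rxz⇏ (≼-trans pre (closure-least pre U⊆R x y xy) (closure-least pre U⊆R y z yz))

  GoodCover : BRel m n → Set
  GoodCover U = ∀ x y → U x y ≡ true →
                ∃ λ G → IsGoodRectangular {m} {n} G × G ⊆ U × G x y ≡ true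

  module _ (U : BRel m n) (cover : GoodCover U) where

    private
      T : BRel m n
      T = closure U

      T-pre : IsPreorder {m} {n} T
      T-pre = closure-isPreorder U

    Admissible : Coll m n → Coll m n → Set
    Admissible (inj₁ i) (inj₁ j) = M.LinkedOrDominated T i j
    Admissible (inj₂ i) (inj₂ j) = L.LinkedOrDominated T i j
    Admissible _        _        = ⊤

    admissible? : ∀ x y → Dec (Admissible x y)
    admissible? (inj₁ i) (inj₁ j) = M.linkedOrDominated? T i j
    admissible? (inj₂ i) (inj₂ j) = L.linkedOrDominated? T i j
    admissible? (inj₁ _) (inj₂ _) = yes tt
    admissible? (inj₂ _) (inj₁ _) = yes tt

    admissible-refl : ∀ x → Admissible x x
    admissible-refl (inj₁ i) = M.linkedOrDominated-refl T-pre i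
    admissible-refl (inj₂ i) = L.linkedOrDominated-refl T-pre i

    -- A step through an orthogonal collision is itself a link.
    admissible-trans : ∀ x y z → T x y ≡ true → T y z ≡ true →
                       Admissible x y → Admissible y z → Admissible x z
    admissible-trans (inj₁ _) (inj₁ _) (inj₁ _) xy yz = M.linkedOrDominated-trans T-pre xy yz
    admissible-trans (inj₂ _) (inj₂ _) (inj₂ _) xy yz = L.linkedOrDominated-trans T-pre xy yz
    admissible-trans (inj₁ _) (inj₂ s) (inj₁ _) xy yz _ _ = inj₁ (s , inj₁ (xy , yz))
    admissible-trans (inj₂ _) (inj₁ s) (inj₂ _) xy yz _ _ = inj₁ (s , inj₁ (xy , yz))
    admissible-trans (inj₁ _) (inj₁ _) (inj₂ _) _ _ _ _ = tt
    admissible-trans (inj₁ _) (inj₂ _) (inj₂ _) _ _ _ _ = tt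
    admissible-trans (inj₂ _) (inj₁ _) (inj₁ _) _ _ _ _ = tt
    admissible-trans (inj₂ _) (inj₂ _) (inj₁ _) _ _ _ _ = tt

    admissible-generator : ∀ x y → U x y ≡ true → Admissible x y
    admissible-generator x y Uxy with cover x y Uxy
    ... | G , (G-pre , _ , pcM , pcL) , G⊆U , Gxy = admissible x y Gxy
      where
      G⊆T : G ⊆ T
      G⊆T = ⊆-trans G⊆U (⊆-closure U)

      admissible : ∀ x y → G x y ≡ true → Admissible x y
      admissible (inj₁ _) (inj₁ _) Gxy =
        M.linkedOrDominated-mono G⊆T (M.≼⇒linkedOrDominated G-pre pcM Gxy)
      admissible (inj₂ _) (inj₂ _) Gxy =
        L.linkedOrDominated-mono G⊆T (L.≼⇒linkedOrDominated G-pre pcL Gxy)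
      admissible (inj₁ _) (inj₂ _) _ = tt
      admissible (inj₂ _) (inj₁ _) _ = tt

    -- T ∩ Admissible is a preorder containing U, hence contains T; this
    -- replaces an induction along chains of U-steps.
    closure-admissible : ∀ x y → T x y ≡ true → Admissible x y
    closure-admissible x y Txy =
      proj₂ (does⇒ (both? x y) (closure-least T∩A-pre U⊆T∩A x y Txy))
      where
      both? : ∀ x y → Dec (T x y ≡ true × Admissible x y)
      both? x y = ≼? T x y ×-dec admissible? x y

      T∩A-pre : IsPreorder {m} {n} (λ x y → does (both? x y))
      T∩A-pre =
        (λ x → dec-true (both? x x) (proj₁ T-pre x , admissible-refl x)) ,
        λ x y z xy yz →
          let (Txy , Axy) = does⇒ (both? x y) xy
              (Tyz , Ayz) = does⇒ (both? y z) yz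
          in dec-true (both? x z)
                      (≼-trans T-pre Txy Tyz , admissible-trans x y z Txy Tyz Axy Ayz)

      U⊆T∩A : U ⊆ (λ x y → does (both? x y))
      U⊆T∩A x y Uxy = dec-true (both? x y) (⊆-closure U x y Uxy , admissible-generator x y Uxy)

    closure-isGoodRectangular : (∃ λ G → IsGoodRectangular {m} {n} G × G ⊆ U) →
                                IsGoodRectangular {m} {n} T
    closure-isGoodRectangular (G , (_ , orth , pcM , pcL) , G⊆U) =
      T-pre , (λ j i → comparable-mono G⊆T (orth j i)) ,
      M.parallelCond-from-linkedOrDominated T-pre G⊆T pcM
        (λ i j → closure-admissible (inj₁ i) (inj₁ j)) ,
      L.parallelCond-from-linkedOrDominated T-pre G⊆T pcL
        (λ i j → closure-admissible (inj₂ i) (inj₂ j))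
      where
      G⊆T : G ⊆ T
      G⊆T = ⊆-trans G⊆U (⊆-closure U)

  _∪_ : BRel m n → BRel m n → BRel m n
  (P ∪ Q) x y = P x y ∨ Q x y

  ⊆-∪ˡ : ∀ P Q → P ⊆ P ∪ Q
  ⊆-∪ˡ P Q x y Pxy rewrite Pxy = refl

  ⊆-∪ʳ : ∀ P Q → Q ⊆ P ∪ Q
  ⊆-∪ʳ P Q x y Qxy rewrite Qxy = ∨-zeroʳ (P x y)

  ∪-elim : ∀ P Q x y → (P ∪ Q) x y ≡ true → P x y ≡ true ⊎ Q x y ≡ true
  ∪-elim P Q x y PQxy with P x y
  ... | true  = inj₁ refl
  ... | false = inj₂ PQxy

  join : C m n → C m n → C m n
  join (P , P-good) (Q , Q-good) =
    closure (P ∪ Q) , closure-isGoodRectangular (P ∪ Q) cover (P , P-good , ⊆-∪ˡ P Q)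
    where
    cover : GoodCover (P ∪ Q)
    cover x y PQxy = [ (λ Pxy → P , P-good , ⊆-∪ˡ P Q , Pxy)
                     , (λ Qxy → Q , Q-good , ⊆-∪ʳ P Q , Qxy) ]′ (∪-elim P Q x y PQxy)

  join-supremum : Supremum (_⊑_ {m} {n}) join
  join-supremum (P , _) (Q , _) =
    ⊆-trans (⊆-∪ˡ P Q) (⊆-closure (P ∪ Q)) ,
    ⊆-trans (⊆-∪ʳ P Q) (⊆-closure (P ∪ Q)) ,
    λ (Z , (Z-pre , _)) P⊆Z Q⊆Z → closure-least Z-pre λ x y PQxy →
      [ P⊆Z x y , Q⊆Z x y ]′ (∪-elim P Q x y PQxy)

  _∨⊥_ : C⊥ m n → C⊥ m n → C⊥ m n
  nothing ∨⊥ Y       = Y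
  just X  ∨⊥ nothing = just X
  just X  ∨⊥ just Y  = just (join X Y)

  ∨⊥-supremum : Supremum (Ord⊥ m n) _∨⊥_
  ∨⊥-supremum nothing  nothing  = tt , tt , λ _ _ _ → tt
  ∨⊥-supremum nothing  (just Y) = tt , (λ _ _ Yxy → Yxy) , λ _ _ Y⊑Z → Y⊑Z
  ∨⊥-supremum (just X) nothing  = (λ _ _ Xxy → Xxy) , tt , λ _ X⊑Z _ → X⊑Z
  ∨⊥-supremum (just X) (just Y) =
    let (X⊑XY , Y⊑XY , least) = join-supremum X Y
    in X⊑XY , Y⊑XY , λ { nothing () _ ; (just Z) → least Z }

  LowerBound : BRel m n → BRel m n → BRel m n → Set
  LowerBound P Q R = IsGoodRectangular {m} {n} R × R ⊆ P × R ⊆ Q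

  lowerBound? : ∀ P Q R → Dec (LowerBound P Q R)
  lowerBound? P Q R = isGoodRectangular? R ×-dec (⊆? R P ×-dec ⊆? R Q)

  lowerBound-resp : ∀ {P Q R S} → R ≐ S → LowerBound P Q R → LowerBound P Q S
  lowerBound-resp R≐S (R-good , R⊆P , R⊆Q) =
    isGoodRectangular-resp R≐S R-good ,
    ⊆-trans (≐⇒⊆ (≐-sym R≐S)) R⊆P , ⊆-trans (≐⇒⊆ (≐-sym R≐S)) R⊆Q

  someLowerBound? : ∀ P Q → Dec (∃ (LowerBound P Q))
  someLowerBound? P Q = searchable-BRel (LowerBound P Q) lowerBound-resp (lowerBound? P Q)

  lowerBoundThrough? : ∀ P Q x y → Dec (∃ λ R → LowerBound P Q R × R x y ≡ true)
  lowerBoundThrough? P Q x y = searchable-BRel _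
    (λ R≐S (lower , Rxy) → lowerBound-resp R≐S lower , ≐⇒⊆ R≐S x y Rxy)
    (λ R → lowerBound? P Q R ×-dec ≼? R x y)

  opaque
    lowerBoundUnion : BRel m n → BRel m n → BRel m n
    lowerBoundUnion P Q x y = does (lowerBoundThrough? P Q x y)

    ⊆-lowerBoundUnion : ∀ {P Q R} → LowerBound P Q R → R ⊆ lowerBoundUnion P Q
    ⊆-lowerBoundUnion {P} {Q} {R} lower x y Rxy =
      dec-true (lowerBoundThrough? P Q x y) (R , lower , Rxy)

    lowerBoundUnion-lowerBound : ∀ P Q x y → lowerBoundUnion P Q x y ≡ true →
                                 ∃ λ R → LowerBound P Q R × R x y ≡ true
    lowerBoundUnion-lowerBound P Q x y = does⇒ (lowerBoundThrough? P Q x y)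

  lowerBoundUnion-cover : ∀ P Q → GoodCover (lowerBoundUnion P Q)
  lowerBoundUnion-cover P Q x y PQxy =
    let (R , lower , Rxy) = lowerBoundUnion-lowerBound P Q x y PQxy
    in R , proj₁ lower , ⊆-lowerBoundUnion lower , Rxy

  lowerBoundUnion-⊆ˡ : ∀ P Q → lowerBoundUnion P Q ⊆ P
  lowerBoundUnion-⊆ˡ P Q x y PQxy =
    let (R , (_ , R⊆P , _) , Rxy) = lowerBoundUnion-lowerBound P Q x y PQxy in R⊆P x y Rxy

  lowerBoundUnion-⊆ʳ : ∀ P Q → lowerBoundUnion P Q ⊆ Q
  lowerBoundUnion-⊆ʳ P Q x y PQxy =
    let (R , (_ , _ , R⊆Q) , Rxy) = lowerBoundUnion-lowerBound P Q x y PQxy in R⊆Q x y Rxy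

  meetWith : (X Y : C m n) → Dec (∃ (LowerBound (proj₁ X) (proj₁ Y))) → C⊥ m n
  meetWith (P , _) (Q , _) (yes (R , lower)) =
    just (closure (lowerBoundUnion P Q) ,
          closure-isGoodRectangular _ (lowerBoundUnion-cover P Q)
            (R , proj₁ lower , ⊆-lowerBoundUnion lower))
  meetWith _ _ (no _) = nothing

  meetWith-infimum : ∀ X Y d →
    Ord⊥ m n (meetWith X Y d) (just X) × Ord⊥ m n (meetWith X Y d) (just Y) ×
    (∀ Z → Ord⊥ m n Z (just X) → Ord⊥ m n Z (just Y) → Ord⊥ m n Z (meetWith X Y d))
  meetWith-infimum (P , P-good) (Q , Q-good) (yes _) =
    closure-least (proj₁ P-good) (lowerBoundUnion-⊆ˡ P Q) ,
    closure-least (proj₁ Q-good) (lowerBoundUnion-⊆ʳ P Q) ,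
    λ { nothing _ _ → tt
      ; (just (Z , Z-good)) Z⊆P Z⊆Q →
          ⊆-trans (⊆-lowerBoundUnion (Z-good , Z⊆P , Z⊆Q)) (⊆-closure _) }
  meetWith-infimum _ _ (no none) =
    tt , tt , λ { nothing _ _ → tt ; (just (Z , Z-good)) Z⊆P Z⊆Q → none (Z , Z-good , Z⊆P , Z⊆Q) }

  _∧⊥_ : C⊥ m n → C⊥ m n → C⊥ m n
  nothing ∧⊥ _       = nothing
  just _  ∧⊥ nothing = nothing
  just X  ∧⊥ just Y  = meetWith X Y (someLowerBound? (proj₁ X) (proj₁ Y))

  ∧⊥-infimum : Infimum (Ord⊥ m n) _∧⊥_
  ∧⊥-infimum nothing  _        = tt , tt , λ _ Z⊑⊥ _ → Z⊑⊥
  ∧⊥-infimum (just _) nothing  = tt , tt , λ _ _ Z⊑⊥ → Z⊑⊥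
  ∧⊥-infimum (just X) (just Y) = meetWith-infimum X Y (someLowerBound? (proj₁ X) (proj₁ Y))

mainTheorem2 : (m n : ℕ) → 1 ≤ m → 1 ≤ n →
    Σ (Op₂ (C⊥ m n)) (λ _∨_ → Supremum (Ord⊥ m n) _∨_)
      × Σ (Op₂ (C⊥ m n)) (λ _∧_ → Infimum (Ord⊥ m n) _∧_)
mainTheorem2 m n _ _ = (_∨⊥_ {m} {n} , ∨⊥-supremum) , (_∧⊥_ {m} {n} , ∧⊥-infimum)
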